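{- Let $(\mathscr{L},W)$ be a logical structure with $W$ monotonic. For $\Sigma\subseteq\mathscr{L}$ define $\mu_\Sigma:\mathscr{L}\to\{0,1,2,3\}$ by $\mu_\Sigma(\beta)=0$ if $\beta\notin W(\Sigma)\cup\Sigma$, $1$ if $\beta\in\Sigma\cap W(\Sigma)$, $2$ if $\beta\in\Sigma\setminus W(\Sigma)$, $3$ if $\beta\in W(\Sigma)\setminus\Sigma$. Let $\mathbf{M}=\{\mu_\Sigma:\Sigma\subseteq\mathscr{L}\}$, and for $m\in\mathbf{M}$, $\Gamma\subseteq\mathscr{L}$ let $m\models_1\Gamma$ iff $m(\Gamma)\subseteq\{1,2\}$ and $m\models_2\Gamma$ iff $m(\Gamma)\subseteq\{1,3\}$. Let $\mathfrak{S}=(\mathbf{M},\models_1,\models_2,S,\mathcal{P}(\mathscr{L}))$ with $S=\{(\models_1,\models_2)\}$. Then $W=W_{\mathfrak{S}}$.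
   Context: A logical structure is a pair $(\mathscr{L},W)$ with $\mathscr{L}$ a set and $W:\mathcal{P}(\mathscr{L})\to\mathcal{P}(\mathscr{L})$; $W$ is monotonic if $\Gamma\subseteq\Sigma$ implies $W(\Gamma)\subseteq W(\Sigma)$. For a semantics $(\mathbf{M},\{\models_i\}_{i\in I},S,\mathcal{P}(\mathscr{L}))$ (with $\models_i\subseteq\mathbf{M}\times\mathcal{P}(\mathscr{L})$ and $\emptyset\ne S$ a set of pairs $(\models_i,\models_j)$), $W_{\mathfrak{S}}$ is defined by: $\alpha\in W_{\mathfrak{S}}(\Gamma)$ iff for all $(\models_i,\models_j)\in S$ and all $m\in\mathbf{M}$, $m\models_i\Gamma$ implies $m\models_j\{\alpha\}$. -}

module Defs where

open import Data.Bool using (Bool; true; false; T)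
open import Relation.Binary.PropositionalEquality using (_≡_)
open import Data.Sum using (_⊎_)
open import Data.Product using (_×_)

Subset : Set → Set
Subset L = L → Bool

_∈ₛ_ : {L : Set} → L → Subset L → Set
β ∈ₛ Γ = T (Γ β)

_⊆ₛ_ : {L : Set} → Subset L → Subset L → Set
Γ ⊆ₛ Σ = ∀ β → β ∈ₛ Γ → β ∈ₛ Σ

Monotonic : {L : Set} → (Subset L → Subset L) → Set
Monotonic W = ∀ Γ Σ → Γ ⊆ₛ Σ → W Γ ⊆ₛ W Σ

data Four : Set where
  v0 v1 v2 v3 : Four

μval : Bool → Bool → Four
μval false false = v0
μval true  true  = v1
μval true  false = v2
μval false true  = v3

μ : {L : Set} → (Subset L → Subset L) → Subset L → L → Four
μ W Σ β = μval (Σ β) (W Σ β)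

ImageIn : {L : Set} → (L → Four) → (L → Set) → (Four → Set) → Set
ImageIn m Γ P = ∀ β → Γ β → P (m β)

In12 : Four → Set
In12 x = (x ≡ v1) ⊎ (x ≡ v2)

In13 : Four → Set
In13 x = (x ≡ v1) ⊎ (x ≡ v3)

_⊨₁_ : {L : Set} → (L → Four) → (L → Set) → Set
m ⊨₁ Γ = ImageIn m Γ In12

_⊨₂_ : {L : Set} → (L → Four) → (L → Set) → Set
m ⊨₂ Γ = ImageIn m Γ In13

asPred : {L : Set} → Subset L → (L → Set)
asPred Γ β = β ∈ₛ Γ

singleton : {L : Set} → L → (L → Set)
singleton α β = β ≡ α

-- W_𝔖 for 𝔖 = (M, ⊨₁, ⊨₂, S = {(⊨₁,⊨₂)}), M = {μ_Σ : Σ ⊆ L}: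
-- α ∈ W_𝔖(Γ) iff for every m = μ_Σ ∈ M, m ⊨₁ Γ implies m ⊨₂ {α}.
-- (S is a singleton, so quantifying over pairs in S is just this one pair.)
InW𝔖 : {L : Set} → (Subset L → Subset L) → Subset L → L → Set
InW𝔖 {L} W Γ α = ∀ (Σ : Subset L) → μ W Σ ⊨₁ asPred Γ → μ W Σ ⊨₂ singleton α

{-# OPTIONS --safe #-}
module Submission where

-- μ_Σ ⊨₁ Γ says exactly Γ ⊆ Σ, and μ_Σ ⊨₂ {α} says exactly α ∈ W(Σ). Hence
-- W_𝔖(Γ) is the intersection of the W(Σ) over all Σ ⊇ Γ, which is W(Γ): the
-- inclusion ⊇ is monotonicity, and ⊆ takes Σ = Γ.

open import Defs
open import Function.Bundles using (_⇔_; mk⇔; Equivalence)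
open import Data.Bool using (true; false; T)
open import Data.Sum using (inj₁; inj₂)
open import Data.Unit using (tt)
open import Relation.Binary.PropositionalEquality using (refl)

open Equivalence using (to; from)

In12-μval⇔T₁ : ∀ a b → In12 (μval a b) ⇔ T a
In12-μval⇔T₁ a b = mk⇔ (in12⇒ a b) (⇒in12 a b)
  where
  in12⇒ : ∀ a b → In12 (μval a b) → T a
  in12⇒ true  _     _        = tt
  in12⇒ false false (inj₁ ())
  in12⇒ false false (inj₂ ())
  in12⇒ false true  (inj₁ ())
  in12⇒ false true  (inj₂ ())

  ⇒in12 : ∀ a b → T a → In12 (μval a b)
  ⇒in12 true true  _ = inj₁ refl
  ⇒in12 true false _ = inj₂ refl

In13-μval⇔T₂ : ∀ a b → In13 (μval a b) ⇔ T b
In13-μval⇔T₂ a b = mk⇔ (in13⇒ a b) (⇒in13 a b)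
  where
  in13⇒ : ∀ a b → In13 (μval a b) → T b
  in13⇒ _     true  _        = tt
  in13⇒ false false (inj₁ ())
  in13⇒ false false (inj₂ ())
  in13⇒ true  false (inj₁ ())
  in13⇒ true  false (inj₂ ())

  ⇒in13 : ∀ a b → T b → In13 (μval a b)
  ⇒in13 true  true _ = inj₁ refl
  ⇒in13 false true _ = inj₂ refl

module _ {L : Set} (W : Subset L → Subset L) where

  μ-⊨₁⇔⊆ : ∀ (Σ Γ : Subset L) → μ W Σ ⊨₁ asPred Γ ⇔ Γ ⊆ₛ Σ
  μ-⊨₁⇔⊆ Σ Γ = mk⇔
    (λ m⊨Γ β β∈Γ → to   (In12-μval⇔T₁ (Σ β) (W Σ β)) (m⊨Γ β β∈Γ))
    (λ Γ⊆Σ β β∈Γ → from (In12-μval⇔T₁ (Σ β) (W Σ β)) (Γ⊆Σ β β∈Γ))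

  μ-⊨₂-singleton⇔∈W : ∀ (Σ : Subset L) (α : L) → μ W Σ ⊨₂ singleton α ⇔ α ∈ₛ W Σ
  μ-⊨₂-singleton⇔∈W Σ α = mk⇔
    (λ m⊨α → to (In13-μval⇔T₂ (Σ α) (W Σ α)) (m⊨α α refl))
    (λ { α∈WΣ .α refl → from (In13-μval⇔T₂ (Σ α) (W Σ α)) α∈WΣ })

mainTheorem7 : (L : Set) (W : Subset L → Subset L) → Monotonic W →
                 ∀ (Γ : Subset L) (α : L) → (α ∈ₛ W Γ) ⇔ InW𝔖 W Γ α
mainTheorem7 L W mono Γ α = mk⇔ ∈W⇒∈W𝔖 ∈W𝔖⇒∈W
  where
  ∈W⇒∈W𝔖 : α ∈ₛ W Γ → InW𝔖 W Γ α
  ∈W⇒∈W𝔖 α∈WΓ Σ μ⊨Γ =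
    from (μ-⊨₂-singleton⇔∈W W Σ α) (mono Γ Σ (to (μ-⊨₁⇔⊆ W Σ Γ) μ⊨Γ) α α∈WΓ)

  ∈W𝔖⇒∈W : InW𝔖 W Γ α → α ∈ₛ W Γ
  ∈W𝔖⇒∈W α∈W𝔖Γ =
    to (μ-⊨₂-singleton⇔∈W W Γ α) (α∈W𝔖Γ Γ (from (μ-⊨₁⇔⊆ W Γ Γ) (λ _ β∈Γ → β∈Γ)))
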